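{- Let $\hat G=(V,\hat E)$ be a finite simple undirected graph, and run the following Pivot procedure on $\hat G$: set $V'\gets V$; while $V'\neq\emptyset$, let $G'=(V',E')$ be the subgraph of $\hat G$ induced by $V'$, select a pivot $k\in V'$, form the cluster $C_k=\{k\}\cup\{i\in V':(i,k)\in E'\}$, add $C_k$ to the output clustering, and set $V'\gets V'\setminus C_k$. Let $\mathcal B$ be the set of edges of $\hat G$ whose endpoints lie in different output clusters, and let $\mathcal N$ be the set of unordered pairs of distinct nodes $\{i,j\}$ with $(i,j)\notin\hat E$ that lie in the same output cluster. If every pivot is chosen by Pivot Strategy 1 or by Pivot Strategy 2, then $|\mathcal B|\le 2|\mathcal N|$. If every pivot is chosen by Pivot Strategy 3, then $\mathbb E[|\mathcal B|]=2\,\mathbb E[|\mathcal N|]$.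
   Context: For the current induced subgraph $G'=(V',E')$ and a node $k\in V'$, let $\mathit{deg}_k(G')$ be the number of neighbors of $k$ in $G'$, and define $B_k(G')=\{(i,j)\in E' : (i,k)\in E',\ (j,k)\notin E'\}$ (edges on the boundary of the cluster around $k$) and $N_k(G')=\{\{i,j\}\subseteq V' : (i,j)\notin E',\ (i,k)\in E',\ (j,k)\in E'\}$ (non-edges inside the cluster around $k$). Pivot Strategy 1: select a pivot $k\in V'$ of maximum degree in $G'$. Pivot Strategy 2: select a pivot $k\in V'$ minimizing $|B_k(G')|/|N_k(G')|$. Pivot Strategy 3: select a pivot uniformly at random from $V'$. -}

module Defs where

open import Data.Bool using (Bool; true; false; _∧_; not; T)
open import Data.Nat using (ℕ; zero; suc; _+_; _*_; _≤_; _<ᵇ_)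
open import Data.Fin using (Fin; toℕ)
open import Data.Fin.Subset using (Subset; _∩_; _─_; ⁅_⁆; _∪_; ∣_∣; ⊥)
open import Data.Vec using (lookup; tabulate)
open import Data.List using (List; []; _∷_; map; length; concatMap; filterᵇ; allFin)
open import Data.Bool.ListAction using (any)
open import Data.Product using (_×_; _,_)
open import Data.Sum using (_⊎_)
open import Data.Integer using (+_)
open import Data.Rational using (ℚ; 0ℚ; _/_) renaming (_+_ to _+ℚ_; _*_ to _*ℚ_)
open import Relation.Binary.PropositionalEquality using (_≡_)

record Graph (n : ℕ) : Set where
  field
    adj    : Fin n → Fin n → Bool
    sym    : ∀ i j → adj i j ≡ adj j i
    irrefl : ∀ i → adj i i ≡ false
open Graph public

module _ {n : ℕ} where

  mem : Fin n → Subset n → Bool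
  mem i V = lookup V i

  elems : Subset n → List (Fin n)
  elems V = filterᵇ (λ i → mem i V) (allFin n)

  countOrdered : (Fin n → Fin n → Bool) → ℕ
  countOrdered p =
    length (filterᵇ (λ ij → pr ij) (concatMap (λ i → map (λ j → (i , j)) (allFin n)) (allFin n)))
    where
      pr : Fin n × Fin n → Bool
      pr (i , j) = p i j

  countUnordered : (Fin n → Fin n → Bool) → ℕ
  countUnordered p = countOrdered (λ i j → (toℕ i <ᵇ toℕ j) ∧ p i j)

  module _ (G : Graph n) where

    nbhd : Subset n → Fin n → Subset n
    nbhd V k = V ∩ tabulate (adj G k)

    deg : Subset n → Fin n → ℕ
    deg V k = ∣ nbhd V k ∣

    cluster : Subset n → Fin n → Subset n
    cluster V k = ⁅ k ⁆ ∪ nbhd V k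

    Bk : Subset n → Fin n → ℕ
    Bk V k = countOrdered (λ i j → mem i (cluster V k) ∧ (mem j (V ─ cluster V k) ∧ adj G i j))

    Nk : Subset n → Fin n → ℕ
    Nk V k = countUnordered (λ i j → mem i (cluster V k) ∧ (mem j (cluster V k) ∧ not (adj G i j)))

    Strategy1 : Subset n → Fin n → Set
    Strategy1 V k = ∀ k′ → T (mem k′ V) → deg V k′ ≤ deg V k

    -- Pivot Strategy 2: k minimises |B_k(G')| / |N_k(G')|, ratios compared
    -- by cross-multiplication: B_k * N_k′ ≤ B_k′ * N_k for all k′ ∈ V'
    Strategy2 : Subset n → Fin n → Set
    Strategy2 V k = ∀ k′ → T (mem k′ V) → Bk V k * Nk V k′ ≤ Bk V k′ * Nk V k

    data PivotRun (P : Subset n → Fin n → Set) : Subset n → List (Subset n) → Set where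
      done : PivotRun P ⊥ []
      step : ∀ {V Cs} (k : Fin n) → T (mem k V) → P V k →
             PivotRun P (V ─ cluster V k) Cs →
             PivotRun P V (cluster V k ∷ Cs)

    sameCluster : List (Subset n) → Fin n → Fin n → Bool
    sameCluster Cs i j = any (λ C → mem i C ∧ mem j C) Cs

    cutEdges : List (Subset n) → ℕ
    cutEdges Cs = countUnordered (λ i j → adj G i j ∧ not (sameCluster Cs i j))

    intraNonEdges : List (Subset n) → ℕ
    intraNonEdges Cs = countUnordered (λ i j → not (adj G i j) ∧ sameCluster Cs i j)

    avg : List ℚ → ℚ
    avg []       = 0ℚ
    avg (x ∷ xs) = sumℚ (x ∷ xs) *ℚ (+ 1 / suc (length xs))
      where
        sumℚ : List ℚ → ℚ
        sumℚ []       = 0ℚ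
        sumℚ (y ∷ ys) = y +ℚ sumℚ ys

    -- Expectation of f(clustering) for the Pivot procedure with uniformly
    -- random pivots (Strategy 3), started from node set V' with the given
    -- fuel (fuel n suffices from V = ⊤, as each step removes the pivot).
    -- f receives the list of clusters produced from V' onward.
    expectRandom : ℕ → Subset n → (List (Subset n) → ℚ) → ℚ
    expectRandom zero     V f = f []
    expectRandom (suc fuel) V f with elems V
    ... | [] = f []
    ... | ks = avg (map (λ k → expectRandom fuel (V ─ cluster V k) (λ Cs → f (cluster V k ∷ Cs))) ks)

{-# OPTIONS --safe #-}
-- Every Pivot step, with pivot k on the current node set V, closes the cluster C of k and
-- contributes exactly B_k(V) cut edges and N_k(V) intra-cluster non-edges, so it suffices to
-- compare B_k with 2 N_k step by step. Write B_k = Σ_{i∈C} exits(i), the neighbours of i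
-- outside C, and 2 N_k = Σ_{i∈C} gaps(i), the non-neighbours of i in C other than i. As
-- |C| = 1 + deg k, the inequality exits(i) ≤ gaps(i) is equivalent to deg i ≤ deg k, which
-- settles Strategy 1. For adjacent k and i, exits of i w.r.t. k equals gaps of k w.r.t. i:
-- both count the induced paths k - i - j. Summing over all edges gives Σ_k B_k = 2 Σ_k N_k,
-- so a pivot minimising B_k / N_k has B_k ≤ 2 N_k (Strategy 2), and a uniformly random
-- pivot has E[B_k] = 2 E[N_k], which yields the expectation identity by induction on the
-- remaining node set (Strategy 3).
module Submission where

open import Algebra.Bundles using (CommutativeMonoid)
open import Data.Bool using (Bool; true; false; _∧_; _∨_; not; T; if_then_else_)
open import Data.Bool.Properties
  using (T-≡; ∧-zeroʳ; ∧-identityʳ; ∧-commutativeMonoid;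
         if-not; if-swap-then; if-∧; if-float; if-eta; if-cong-else; if-cong-then)
open import Data.Fin using (Fin; zero; suc; toℕ)
open import Data.Fin.Properties using (_≟_)
open import Data.Fin.Subset using (Subset; _∩_; _∪_; _─_; ⁅_⁆; ⊤; ⊥; ∣_∣)
open import Data.Fin.Subset.Properties using (∣⊤∣≡n)
import Data.Integer as ℤ
import Data.Integer.Properties as ℤP
open import Data.List as List using (List; []; _∷_; length; map; concatMap; filterᵇ)
open import Data.List.Properties using (length-++; filter-++; map-tabulate; length-map; map-cong; map-cong-local)
open import Data.List.Relation.Unary.All as All using (All; []; _∷_)
open import Data.List.Relation.Unary.All.Properties using (all-filter)
open import Data.Nat using (ℕ; zero; suc; _+_; _*_; _≤_; _<ᵇ_; z≤n; s≤s)
open import Data.Nat.ListAction using () renaming (sum to sumˡ)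
open import Data.Nat.Properties
  using (+-*-semiring; +-identityʳ; +-assoc; +-mono-≤; +-cancelˡ-≤; *-zeroʳ; *-comm; *-assoc;
         *-distribˡ-+; *-distribʳ-+; *-cancelʳ-≤; suc-injective; ≤-refl; ≤-reflexive; ≤-trans; ≤-pred;
         m≤m+n; m≤n+m; module ≤-Reasoning)
import Data.Nat.Coprimality as Coprime
open import Data.Product using (_×_; _,_)
open import Data.Rational using (ℚ; mkℚ; _/_; 0ℚ; 1ℚ) renaming (_+_ to _+ℚ_; _*_ to _*ℚ_)
import Data.Rational.Properties as ℚP
open import Data.Sum using (_⊎_; inj₁; inj₂)
open import Data.Vec using ([]; _∷_)
open import Data.Vec.Properties using (lookup-zipWith; lookup-replicate; lookup∘tabulate)
open import Function using (_∘_; id; case_of_; Equivalence)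
open import Relation.Binary.PropositionalEquality
open import Relation.Nullary using (does; yes; no)
open import Relation.Nullary.Decidable using (T?)

open import Algebra.Properties.CommutativeSemigroup
  (CommutativeMonoid.commutativeSemigroup ∧-commutativeMonoid)
  using () renaming (x∙yz≈y∙xz to ∧-leftComm)
open import Algebra.Properties.CommutativeSemigroup
  (CommutativeMonoid.commutativeSemigroup ℚP.+-0-commutativeMonoid)
  using () renaming (interchange to +ℚ-interchange)
open import Algebra.Properties.Semiring.Sum +-*-semiring
  using (sum; sum-cong-≗; sum-replicate-zero; ∑-distrib-+; ∑-comm; *-distribˡ-sum)
open import Defs renaming (sym to adj-sym)

T⇒≡ : ∀ {b} → T b → b ≡ true
T⇒≡ = Equivalence.to T-≡

≡⇒T : ∀ {b} → b ≡ true → T b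
≡⇒T = Equivalence.from T-≡

∧-trueˡ : ∀ {x y} → x ∧ y ≡ true → x ≡ true
∧-trueˡ {true} _ = refl

∧-trueʳ : ∀ {x y} → x ∧ y ≡ true → y ≡ true
∧-trueʳ {true} y≡true = y≡true

not-true : ∀ {x} → not x ≡ true → x ≡ false
not-true {false} _ = refl

∨-falseʳ : ∀ {x y} → x ∨ y ≡ false → y ≡ false
∨-falseʳ {false} y≡false = y≡false

⟦_⟧ : Bool → ℕ
⟦ b ⟧ = if b then 1 else 0

⟦∧⟧ : ∀ x y → ⟦ x ∧ y ⟧ ≡ ⟦ x ⟧ * ⟦ y ⟧
⟦∧⟧ true  y = sym (+-identityʳ ⟦ y ⟧)
⟦∧⟧ false y = refl

⟦∧-∧⟧ : ∀ x y s → ⟦ x ∧ (y ∧ s) ⟧ ≡ (if s then ⟦ x ∧ y ⟧ else 0)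
⟦∧-∧⟧ x y true  rewrite ∧-identityʳ y = refl
⟦∧-∧⟧ x y false rewrite ∧-zeroʳ y | ∧-zeroʳ x = refl

_<ᶠ_ : ∀ {m} → Fin m → Fin m → Bool
i <ᶠ j = toℕ i <ᵇ toℕ j

<ᶠ-split : ∀ {m} (i j : Fin m) → ⟦ i <ᶠ j ⟧ + ⟦ j <ᶠ i ⟧ ≡ ⟦ not (does (i ≟ j)) ⟧
<ᶠ-split zero    zero    = refl
<ᶠ-split zero    (suc j) = refl
<ᶠ-split (suc i) zero    = refl
<ᶠ-split (suc i) (suc j) = <ᶠ-split i j

when-cong : ∀ b {x y} → (b ≡ true → x ≡ y) → (if b then x else 0) ≡ (if b then y else 0)
when-cong true  x≡y = x≡y refl
when-cong false _   = refl

when-mono-≤ : ∀ b {x y} → (b ≡ true → x ≤ y) → (if b then x else 0) ≤ (if b then y else 0)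
when-mono-≤ true  x≤y = x≤y refl
when-mono-≤ false _   = ≤-refl

when-distrib-+ : ∀ b {x y} → (if b then x + y else 0) ≡ (if b then x else 0) + (if b then y else 0)
when-distrib-+ true  = refl
when-distrib-+ false = refl

*-when : ∀ c b {x} → c * (if b then x else 0) ≡ (if b then c * x else 0)
*-when c b = trans (if-float (c *_) b) (if-cong-else b (*-zeroʳ c))

sum-zero : ∀ {m} → sum {m} (λ _ → 0) ≡ 0
sum-zero {m} = sum-replicate-zero m

when-sum : ∀ {m} b (g : Fin m → ℕ) → (if b then sum g else 0) ≡ sum (λ i → if b then g i else 0)
when-sum true  g = refl
when-sum {m} false g = sym (sum-zero {m})

sum-mono-≤ : ∀ {m} {f g : Fin m → ℕ} → (∀ i → f i ≤ g i) → sum f ≤ sum g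
sum-mono-≤ {zero}  _   = z≤n
sum-mono-≤ {suc m} f≤g = +-mono-≤ (f≤g zero) (sum-mono-≤ (f≤g ∘ suc))

sum-point : ∀ {m} (f : Fin m → ℕ) i → f i ≤ sum f
sum-point f zero    = m≤m+n _ _
sum-point f (suc i) = ≤-trans (sum-point (f ∘ suc) i) (m≤n+m _ (f zero))

sum-δ : ∀ {m} (k : Fin m) (f : Fin m → ℕ) → sum (λ i → if does (k ≟ i) then f i else 0) ≡ f k
sum-δ {suc m} zero f = trans (cong (f zero +_) (sum-zero {m})) (+-identityʳ (f zero))
sum-δ (suc k) f = sum-δ k (f ∘ suc)

mem-∩ : ∀ {m} (p q : Subset m) i → mem i (p ∩ q) ≡ mem i p ∧ mem i q
mem-∩ p q i = lookup-zipWith _∧_ i p q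

mem-∪ : ∀ {m} (p q : Subset m) i → mem i (p ∪ q) ≡ mem i p ∨ mem i q
mem-∪ p q i = lookup-zipWith _∨_ i p q

mem-─ : ∀ {m} (p q : Subset m) i → mem i (p ─ q) ≡ mem i p ∧ not (mem i q)
mem-─ (x ∷ p) (true  ∷ q) zero    = sym (∧-zeroʳ x)
mem-─ (x ∷ p) (false ∷ q) zero    = sym (∧-identityʳ x)
mem-─ (_ ∷ p) (_     ∷ q) (suc i) = mem-─ p q i

mem-⊤ : ∀ {m} (i : Fin m) → mem i ⊤ ≡ true
mem-⊤ i = lookup-replicate i true

mem-⊥ : ∀ {m} (i : Fin m) → mem i ⊥ ≡ false
mem-⊥ i = lookup-replicate i false

mem-⁅⁆ : ∀ {m} (k i : Fin m) → mem i ⁅ k ⁆ ≡ does (k ≟ i)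
mem-⁅⁆ zero    zero    = refl
mem-⁅⁆ zero    (suc i) = mem-⊥ i
mem-⁅⁆ (suc k) zero    = refl
mem-⁅⁆ (suc k) (suc i) = mem-⁅⁆ k i

module _ {n : ℕ} where

  ∑∈ : Subset n → (Fin n → ℕ) → ℕ
  ∑∈ V f = sum (λ i → if mem i V then f i else 0)

  infixr 5 ∑∈
  syntax ∑∈ V (λ i → e) = ∑[ i ∈ V ] e

  _⊆ᵇ_ : Subset n → Subset n → Set
  A ⊆ᵇ B = ∀ {i} → mem i A ≡ true → mem i B ≡ true

  ─-⊆ : ∀ (V C : Subset n) → (V ─ C) ⊆ᵇ V
  ─-⊆ V C {i} i∈V─C = ∧-trueˡ (trans (sym (mem-─ V C i)) i∈V─C)

  ─-∉ : ∀ (V C : Subset n) {i} → mem i (V ─ C) ≡ true → mem i C ≡ false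
  ─-∉ V C {i} i∈V─C = not-true (∧-trueʳ (trans (sym (mem-─ V C i)) i∈V─C))

  ⊆ᵇ-∉ : ∀ (A B : Subset n) {i} → A ⊆ᵇ B → mem i B ≡ false → mem i A ≡ false
  ⊆ᵇ-∉ A B {i} A⊆B i∉B with mem i A in i∈A
  ... | false = refl
  ... | true  = trans (sym (A⊆B i∈A)) i∉B

  ∑∈-cong : ∀ V {f g : Fin n → ℕ} → (∀ {i} → mem i V ≡ true → f i ≡ g i) →
            ∑∈ V f ≡ ∑∈ V g
  ∑∈-cong V f≡g = sum-cong-≗ λ i → when-cong (mem i V) f≡g

  ∑∈-mono-≤ : ∀ V {f g : Fin n → ℕ} → (∀ {i} → mem i V ≡ true → f i ≤ g i) →
              ∑∈ V f ≤ ∑∈ V g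
  ∑∈-mono-≤ V f≤g = sum-mono-≤ λ i → when-mono-≤ (mem i V) f≤g

  ∑∈-zero : ∀ V {f : Fin n → ℕ} → (∀ {i} → mem i V ≡ true → f i ≡ 0) → ∑∈ V f ≡ 0
  ∑∈-zero V f≡0 = trans (∑∈-cong V f≡0) (trans (sum-cong-≗ λ i → if-eta (mem i V)) (sum-zero {n}))

  ∑∈²-zero : ∀ (A B : Subset n) → ∑[ i ∈ A ] ∑[ j ∈ B ] 0 ≡ 0
  ∑∈²-zero A B = ∑∈-zero A λ _ → ∑∈-zero B λ _ → refl

  ∑∈-empty : ∀ (V : Subset n) (f : Fin n → ℕ) → (∀ i → mem i V ≡ false) → ∑∈ V f ≡ 0
  ∑∈-empty V f V≡∅ = trans (sum-cong-≗ λ i → cong (if_then f i else 0) (V≡∅ i)) (sum-zero {n})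

  ∑∈-point : ∀ V (f : Fin n → ℕ) {k} → mem k V ≡ true → f k ≤ ∑∈ V f
  ∑∈-point V f {k} k∈V = subst (_≤ ∑∈ V f) (cong (if_then f k else 0) k∈V)
                                (sum-point (λ i → if mem i V then f i else 0) k)

  size≤0⇒empty : ∀ (V : Subset n) → ∑[ i ∈ V ] 1 ≤ 0 → ∀ i → mem i V ≡ false
  size≤0⇒empty V |V|≤0 i with mem i V in i∈V
  ... | false = refl
  ... | true  = case ≤-trans (∑∈-point V (λ _ → 1) i∈V) |V|≤0 of λ ()

  ∑∈-distrib-+ : ∀ V (f g : Fin n → ℕ) → ∑[ i ∈ V ] (f i + g i) ≡ ∑∈ V f + ∑∈ V g
  ∑∈-distrib-+ V f g = trans (sum-cong-≗ λ i → when-distrib-+ (mem i V))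
    (∑-distrib-+ (λ i → if mem i V then f i else 0) (λ i → if mem i V then g i else 0))

  *-distribˡ-∑∈ : ∀ c V (f : Fin n → ℕ) → c * ∑∈ V f ≡ ∑[ i ∈ V ] (c * f i)
  *-distribˡ-∑∈ c V f = trans (*-distribˡ-sum c (λ i → if mem i V then f i else 0))
                              (sum-cong-≗ λ i → *-when c (mem i V))

  ∑∈-comm : ∀ A B (f : Fin n → Fin n → ℕ) →
            ∑[ i ∈ A ] ∑[ j ∈ B ] f i j ≡ ∑[ j ∈ B ] ∑[ i ∈ A ] f i j
  ∑∈-comm A B f = begin
    sum (λ i → if mem i A then sum (λ j → if mem j B then f i j else 0) else 0)
      ≡⟨ sum-cong-≗ (λ i → when-sum (mem i A) (λ j → if mem j B then f i j else 0)) ⟩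
    sum (λ i → sum (λ j → if mem i A then (if mem j B then f i j else 0) else 0))
      ≡⟨ ∑-comm (λ i j → if mem i A then (if mem j B then f i j else 0) else 0) ⟩
    sum (λ j → sum (λ i → if mem i A then (if mem j B then f i j else 0) else 0))
      ≡⟨ sum-cong-≗ (λ j → sum-cong-≗ λ i → if-swap-then (mem i A) (mem j B)) ⟩
    sum (λ j → sum (λ i → if mem j B then (if mem i A then f i j else 0) else 0))
      ≡⟨ sum-cong-≗ (λ j → when-sum (mem j B) (λ i → if mem i A then f i j else 0)) ⟨
    sum (λ j → if mem j B then sum (λ i → if mem i A then f i j else 0) else 0) ∎
    where open ≡-Reasoning

  ∑∈-filter : ∀ X V (b : Fin n → Bool) (f : Fin n → ℕ) → (∀ i → mem i X ≡ mem i V ∧ b i) →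
              ∑∈ X f ≡ ∑[ i ∈ V ] (if b i then f i else 0)
  ∑∈-filter X V b f X≡V∧b = sum-cong-≗ pointwise
    where
    pointwise : ∀ i → (if mem i X then f i else 0) ≡ (if mem i V then (if b i then f i else 0) else 0)
    pointwise i rewrite X≡V∧b i = if-∧ (mem i V)

  ∑∈-δ : ∀ V {k} (f : Fin n → ℕ) → mem k V ≡ true →
         ∑[ i ∈ V ] (if does (k ≟ i) then f i else 0) ≡ f k
  ∑∈-δ V {k} f k∈V = trans (sum-cong-≗ pointwise) (sum-δ k f)
    where
    pointwise : ∀ i → (if mem i V then (if does (k ≟ i) then f i else 0) else 0)
                      ≡ (if does (k ≟ i) then f i else 0)
    pointwise i with k ≟ i
    ... | yes refl = cong (if_then f i else 0) k∈V
    ... | no _     = if-eta (mem i V)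

  ∑∈-split : ∀ (C V : Subset n) → C ⊆ᵇ V → (f : Fin n → ℕ) →
             ∑∈ V f ≡ ∑∈ C f + ∑∈ (V ─ C) f
  ∑∈-split C V C⊆V f = trans (sum-cong-≗ pointwise)
    (∑-distrib-+ (λ i → if mem i C then f i else 0) (λ i → if mem i (V ─ C) then f i else 0))
    where
    pointwise : ∀ i → (if mem i V then f i else 0)
                      ≡ (if mem i C then f i else 0) + (if mem i (V ─ C) then f i else 0)
    pointwise i rewrite mem-─ V C i with mem i C in i∈C
    ... | true  rewrite C⊆V i∈C = sym (+-identityʳ (f i))
    ... | false rewrite ∧-identityʳ (mem i V) = refl

  ∑∈²-split : ∀ (C V : Subset n) → C ⊆ᵇ V → (F : Fin n → Fin n → ℕ) →
              ∑[ i ∈ V ] ∑[ j ∈ V ] F i j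
              ≡ ((∑[ i ∈ C ] ∑[ j ∈ C ] F i j) + (∑[ i ∈ C ] ∑[ j ∈ V ─ C ] F i j))
                + ((∑[ i ∈ V ─ C ] ∑[ j ∈ C ] F i j) + (∑[ i ∈ V ─ C ] ∑[ j ∈ V ─ C ] F i j))
  ∑∈²-split C V C⊆V F = begin
    ∑[ i ∈ V ] ∑[ j ∈ V ] F i j
      ≡⟨ ∑∈-split C V C⊆V _ ⟩
    (∑[ i ∈ C ] ∑[ j ∈ V ] F i j) + (∑[ i ∈ V ─ C ] ∑[ j ∈ V ] F i j)
      ≡⟨ cong₂ _+_ (∑∈-cong C λ _ → ∑∈-split C V C⊆V _)
                   (∑∈-cong (V ─ C) λ _ → ∑∈-split C V C⊆V _) ⟩
    (∑[ i ∈ C ] ((∑[ j ∈ C ] F i j) + (∑[ j ∈ V ─ C ] F i j)))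
      + (∑[ i ∈ V ─ C ] ((∑[ j ∈ C ] F i j) + (∑[ j ∈ V ─ C ] F i j)))
      ≡⟨ cong₂ _+_ (∑∈-distrib-+ C _ _) (∑∈-distrib-+ (V ─ C) _ _) ⟩
    ((∑[ i ∈ C ] ∑[ j ∈ C ] F i j) + (∑[ i ∈ C ] ∑[ j ∈ V ─ C ] F i j))
      + ((∑[ i ∈ V ─ C ] ∑[ j ∈ C ] F i j) + (∑[ i ∈ V ─ C ] ∑[ j ∈ V ─ C ] F i j)) ∎
    where open ≡-Reasoning

  ratio-min-≤ : ∀ (V : Subset n) (b m : Fin n → ℕ) c {k} → mem k V ≡ true →
                (∀ {k′} → mem k′ V ≡ true → b k * m k′ ≤ b k′ * m k) →
                ∑∈ V b ≡ c * ∑∈ V m → b k ≤ c * m k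
  ratio-min-≤ V b m c {k} k∈V minimal ∑b≡c∑m = cancel (∑∈ V m) ∑b≡c∑m (begin
    b k * ∑∈ V m              ≡⟨ *-distribˡ-∑∈ (b k) V m ⟩
    ∑[ k′ ∈ V ] (b k * m k′)  ≤⟨ ∑∈-mono-≤ V minimal ⟩
    ∑[ k′ ∈ V ] (b k′ * m k)  ≡⟨ ∑∈-cong V (λ {k′} _ → *-comm (b k′) (m k)) ⟩
    ∑[ k′ ∈ V ] (m k * b k′)  ≡⟨ *-distribˡ-∑∈ (m k) V b ⟨
    m k * ∑∈ V b              ≡⟨ cong (m k *_) ∑b≡c∑m ⟩
    m k * (c * ∑∈ V m)        ≡⟨ *-assoc (m k) c (∑∈ V m) ⟨
    m k * c * ∑∈ V m          ≡⟨ cong (_* ∑∈ V m) (*-comm (m k) c) ⟩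
    c * m k * ∑∈ V m          ∎)
    where
    open ≤-Reasoning
    cancel : ∀ M → ∑∈ V b ≡ c * M → b k * M ≤ c * m k * M → b k ≤ c * m k
    cancel zero    ∑b≡0 _  =
      ≤-trans (∑∈-point V b k∈V) (≤-trans (≤-reflexive (trans ∑b≡0 (*-zeroʳ c))) z≤n)
    cancel (suc M) _    le = *-cancelʳ-≤ (b k) (c * m k) (suc M) le

∣∣≡∑∈ : ∀ {m} (p : Subset m) → ∣ p ∣ ≡ ∑[ i ∈ p ] 1
∣∣≡∑∈ []          = refl
∣∣≡∑∈ (true  ∷ p) = cong suc (∣∣≡∑∈ p)
∣∣≡∑∈ (false ∷ p) = ∣∣≡∑∈ p

length-filterᵇ-tabulate : ∀ {A : Set} {m} (q : A → Bool) (f : Fin m → A) →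
                          length (filterᵇ q (List.tabulate f)) ≡ sum (λ i → ⟦ q (f i) ⟧)
length-filterᵇ-tabulate {m = zero}  q f = refl
length-filterᵇ-tabulate {m = suc m} q f with q (f zero)
... | true  = cong suc (length-filterᵇ-tabulate q (f ∘ suc))
... | false = length-filterᵇ-tabulate q (f ∘ suc)

length-filterᵇ-concatMap : ∀ {A B : Set} {m} (q : B → Bool) (g : A → List B) (f : Fin m → A) →
                           length (filterᵇ q (concatMap g (List.tabulate f)))
                           ≡ sum (λ i → length (filterᵇ q (g (f i))))
length-filterᵇ-concatMap {m = zero}  q g f = refl
length-filterᵇ-concatMap {m = suc m} q g f = begin
  length (filterᵇ q (g (f zero) List.++ concatMap g (List.tabulate (f ∘ suc))))
    ≡⟨ cong length (filter-++ (T? ∘ q) (g (f zero)) _) ⟩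
  length (filterᵇ q (g (f zero)) List.++ filterᵇ q (concatMap g (List.tabulate (f ∘ suc))))
    ≡⟨ length-++ (filterᵇ q (g (f zero))) ⟩
  length (filterᵇ q (g (f zero))) + length (filterᵇ q (concatMap g (List.tabulate (f ∘ suc))))
    ≡⟨ cong (length (filterᵇ q (g (f zero))) +_) (length-filterᵇ-concatMap q g (f ∘ suc)) ⟩
  sum (λ i → length (filterᵇ q (g (f i)))) ∎
  where open ≡-Reasoning

countOrdered-∑ : ∀ {m} (p : Fin m → Fin m → Bool) →
                 countOrdered p ≡ sum (λ i → sum (λ j → ⟦ p i j ⟧))
countOrdered-∑ {m} p = trans (length-filterᵇ-concatMap p₂ (λ i → map (pair i) (List.allFin m)) id)
  (sum-cong-≗ λ i → trans (cong (length ∘ filterᵇ p₂) (map-tabulate id (pair i)))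
                          (length-filterᵇ-tabulate p₂ (pair i)))
  where
  pair : Fin m → Fin m → Fin m × Fin m
  pair i j = i , j
  p₂ : Fin m × Fin m → Bool
  p₂ (i , j) = p i j

countOrdered-cong : ∀ {m} {p q : Fin m → Fin m → Bool} → (∀ i j → p i j ≡ q i j) →
                    countOrdered p ≡ countOrdered q
countOrdered-cong {p = p} {q} p≡q = trans (countOrdered-∑ p) (trans
  (sum-cong-≗ λ i → sum-cong-≗ λ j → cong ⟦_⟧ (p≡q i j)) (sym (countOrdered-∑ q)))

countOrdered-∈ : ∀ {m} (A B : Subset m) (p : Fin m → Fin m → Bool) →
                 countOrdered (λ i j → mem i A ∧ (mem j B ∧ p i j))
                 ≡ ∑[ i ∈ A ] ∑[ j ∈ B ] ⟦ p i j ⟧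
countOrdered-∈ A B p = trans (countOrdered-∑ λ i j → mem i A ∧ (mem j B ∧ p i j)) (sum-cong-≗ λ i →
  trans (sum-cong-≗ λ j → trans (if-∧ (mem i A)) (if-cong-then (mem i A) (if-∧ (mem j B))))
        (sym (when-sum (mem i A) λ j → if mem j B then ⟦ p i j ⟧ else 0)))

countUnordered-∈ : ∀ {m} (A B : Subset m) (p : Fin m → Fin m → Bool) →
                   countUnordered (λ i j → mem i A ∧ (mem j B ∧ p i j))
                   ≡ ∑[ i ∈ A ] ∑[ j ∈ B ] ⟦ i <ᶠ j ∧ p i j ⟧
countUnordered-∈ A B p = trans
  (countOrdered-cong {q = λ i j → mem i A ∧ (mem j B ∧ (i <ᶠ j ∧ p i j))} λ i j →
    trans (∧-leftComm (i <ᶠ j) (mem i A) (mem j B ∧ p i j))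
          (cong (mem i A ∧_) (∧-leftComm (i <ᶠ j) (mem j B) (p i j))))
  (countOrdered-∈ A B λ i j → i <ᶠ j ∧ p i j)

countUnordered-⊤ : ∀ {m} (p : Fin m → Fin m → Bool) →
                   countUnordered p ≡ ∑[ i ∈ ⊤ ] ∑[ j ∈ ⊤ ] ⟦ i <ᶠ j ∧ p i j ⟧
countUnordered-⊤ p = trans
  (countOrdered-cong {q = λ i j → i <ᶠ j ∧ (mem i ⊤ ∧ (mem j ⊤ ∧ p i j))} λ i j →
    cong (i <ᶠ j ∧_) (sym (cong₂ _∧_ (mem-⊤ i) (cong (_∧ p i j) (mem-⊤ j)))))
  (countUnordered-∈ ⊤ ⊤ p)

∑∈-unordered : ∀ {m} (A B : Subset m) (p : Fin m → Fin m → Bool) → (∀ i j → p i j ≡ p j i) →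
               (∑[ i ∈ A ] ∑[ j ∈ B ] ⟦ i <ᶠ j ∧ p i j ⟧) + (∑[ i ∈ B ] ∑[ j ∈ A ] ⟦ i <ᶠ j ∧ p i j ⟧)
               ≡ ∑[ i ∈ A ] ∑[ j ∈ B ] ⟦ not (does (i ≟ j)) ∧ p i j ⟧
∑∈-unordered A B p p-sym = begin
  ∑<AB + (∑[ i ∈ B ] ∑[ j ∈ A ] ⟦ i <ᶠ j ∧ p i j ⟧)
    ≡⟨ cong (∑<AB +_) (∑∈-comm B A λ i j → ⟦ i <ᶠ j ∧ p i j ⟧) ⟩
  ∑<AB + (∑[ i ∈ A ] ∑[ j ∈ B ] ⟦ j <ᶠ i ∧ p j i ⟧)
    ≡⟨ ∑∈-distrib-+ A _ _ ⟨
  ∑[ i ∈ A ] ((∑[ j ∈ B ] ⟦ i <ᶠ j ∧ p i j ⟧) + (∑[ j ∈ B ] ⟦ j <ᶠ i ∧ p j i ⟧))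
    ≡⟨ ∑∈-cong A (λ {i} _ → ∑∈-distrib-+ B _ _) ⟨
  ∑[ i ∈ A ] ∑[ j ∈ B ] (⟦ i <ᶠ j ∧ p i j ⟧ + ⟦ j <ᶠ i ∧ p j i ⟧)
    ≡⟨ ∑∈-cong A (λ {i} _ → ∑∈-cong B λ {j} _ → both-orders i j) ⟩
  ∑[ i ∈ A ] ∑[ j ∈ B ] ⟦ not (does (i ≟ j)) ∧ p i j ⟧ ∎
  where
  open ≡-Reasoning
  ∑<AB = ∑[ i ∈ A ] ∑[ j ∈ B ] ⟦ i <ᶠ j ∧ p i j ⟧
  both-orders : ∀ i j → ⟦ i <ᶠ j ∧ p i j ⟧ + ⟦ j <ᶠ i ∧ p j i ⟧ ≡ ⟦ not (does (i ≟ j)) ∧ p i j ⟧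
  both-orders i j = begin
    ⟦ i <ᶠ j ∧ p i j ⟧ + ⟦ j <ᶠ i ∧ p j i ⟧
      ≡⟨ cong (λ b → ⟦ i <ᶠ j ∧ p i j ⟧ + ⟦ j <ᶠ i ∧ b ⟧) (p-sym j i) ⟩
    ⟦ i <ᶠ j ∧ p i j ⟧ + ⟦ j <ᶠ i ∧ p i j ⟧
      ≡⟨ cong₂ _+_ (⟦∧⟧ (i <ᶠ j) (p i j)) (⟦∧⟧ (j <ᶠ i) (p i j)) ⟩
    ⟦ i <ᶠ j ⟧ * ⟦ p i j ⟧ + ⟦ j <ᶠ i ⟧ * ⟦ p i j ⟧
      ≡⟨ *-distribʳ-+ ⟦ p i j ⟧ ⟦ i <ᶠ j ⟧ ⟦ j <ᶠ i ⟧ ⟨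
    (⟦ i <ᶠ j ⟧ + ⟦ j <ᶠ i ⟧) * ⟦ p i j ⟧
      ≡⟨ cong (_* ⟦ p i j ⟧) (<ᶠ-split i j) ⟩
    ⟦ not (does (i ≟ j)) ⟧ * ⟦ p i j ⟧
      ≡⟨ ⟦∧⟧ (not (does (i ≟ j))) (p i j) ⟨
    ⟦ not (does (i ≟ j)) ∧ p i j ⟧ ∎

-- One step of the Pivot procedure

module _ {n : ℕ} (G : Graph n) where

  mem-nbhd : ∀ V k i → mem i (nbhd G V k) ≡ mem i V ∧ adj G k i
  mem-nbhd V k i = trans (mem-∩ V _ i) (cong (mem i V ∧_) (lookup∘tabulate (adj G k) i))

  mem-cluster : ∀ V k i → mem i (cluster G V k) ≡ does (k ≟ i) ∨ (mem i V ∧ adj G k i)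
  mem-cluster V k i = trans (mem-∪ ⁅ k ⁆ _ i) (cong₂ _∨_ (mem-⁅⁆ k i) (mem-nbhd V k i))

  cluster-⊆ : ∀ V k → mem k V ≡ true → cluster G V k ⊆ᵇ V
  cluster-⊆ V k k∈V {i} i∈C with k ≟ i | mem-cluster V k i
  ... | yes refl | _       = k∈V
  ... | no _     | C≡nbhd = ∧-trueˡ (trans (sym C≡nbhd) i∈C)

  rest-nonadjacent : ∀ V k {j} → mem j (V ─ cluster G V k) ≡ true → adj G k j ≡ false
  rest-nonadjacent V k {j} j∈R =
    subst (λ b → b ∧ adj G k j ≡ false) (─-⊆ V _ j∈R)
          (∨-falseʳ (trans (sym (mem-cluster V k j)) (─-∉ V _ j∈R)))

  ∑∈-cluster : ∀ V k (f : Fin n → ℕ) → ∑∈ (cluster G V k) f ≡ f k + ∑∈ (nbhd G V k) f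
  ∑∈-cluster V k f = begin
    ∑∈ (cluster G V k) f               ≡⟨ sum-cong-≗ pivot-or-neighbour ⟩
    sum (λ i → pivot i + neighbour i)  ≡⟨ ∑-distrib-+ pivot neighbour ⟩
    sum pivot + ∑∈ (nbhd G V k) f      ≡⟨ cong (_+ ∑∈ (nbhd G V k) f) (sum-δ k f) ⟩
    f k + ∑∈ (nbhd G V k) f            ∎
    where
    open ≡-Reasoning
    pivot neighbour : Fin n → ℕ
    pivot     i = if does (k ≟ i) then f i else 0
    neighbour i = if mem i (nbhd G V k) then f i else 0
    pivot-or-neighbour : ∀ i → (if mem i (cluster G V k) then f i else 0)
                               ≡ (if does (k ≟ i) then f i else 0) + (if mem i (nbhd G V k) then f i else 0)
    pivot-or-neighbour i rewrite mem-cluster V k i | mem-nbhd V k i with k ≟ i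
    ... | yes refl rewrite irrefl G k | ∧-zeroʳ (mem k V) = sym (+-identityʳ (f k))
    ... | no _     = refl

  ∑∈-cluster-nbhd : ∀ V k (f : Fin n → ℕ) → f k ≡ 0 →
                    ∑∈ (cluster G V k) f ≡ ∑∈ (nbhd G V k) f
  ∑∈-cluster-nbhd V k f fₖ≡0 = trans (∑∈-cluster V k f) (cong (_+ ∑∈ (nbhd G V k) f) fₖ≡0)

  deg-∑∈ : ∀ V i → deg G V i ≡ ∑[ j ∈ V ] ⟦ adj G i j ⟧
  deg-∑∈ V i =
    trans (∣∣≡∑∈ (nbhd G V i)) (∑∈-filter (nbhd G V i) V (adj G i) (λ _ → 1) (mem-nbhd V i))

  cluster-size : ∀ V k → ∑[ j ∈ cluster G V k ] 1 ≡ suc (deg G V k)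
  cluster-size V k = trans (∑∈-cluster V k (λ _ → 1)) (cong suc (sym (∣∣≡∑∈ (nbhd G V k))))

  clusters-inside : ∀ V k {Cs} → mem k V ≡ true → All (_⊆ᵇ (V ─ cluster G V k)) Cs →
                    All (_⊆ᵇ V) (cluster G V k ∷ Cs)
  clusters-inside V k k∈V Cs⊆R =
    cluster-⊆ V k k∈V ∷ All.map (λ C⊆R {i} i∈C → ─-⊆ V (cluster G V k) (C⊆R i∈C)) Cs⊆R

  sameCluster-∉ˡ : ∀ W {Cs i j} → All (_⊆ᵇ W) Cs → mem i W ≡ false → sameCluster G Cs i j ≡ false
  sameCluster-∉ˡ W []                                        _   = refl
  sameCluster-∉ˡ W {C ∷ Cs} {i} {j} (C⊆W ∷ Cs⊆W) i∉W =
    trans (cong (λ a → (a ∧ mem j C) ∨ sameCluster G Cs i j) (⊆ᵇ-∉ C W C⊆W i∉W))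
          (sameCluster-∉ˡ W Cs⊆W i∉W)

  sameCluster-∉ʳ : ∀ W {Cs i j} → All (_⊆ᵇ W) Cs → mem j W ≡ false → sameCluster G Cs i j ≡ false
  sameCluster-∉ʳ W []                                        _   = refl
  sameCluster-∉ʳ W {C ∷ Cs} {i} {j} (C⊆W ∷ Cs⊆W) j∉W = begin
    (mem i C ∧ mem j C) ∨ sameCluster G Cs i j
      ≡⟨ cong (λ b → (mem i C ∧ b) ∨ sameCluster G Cs i j) (⊆ᵇ-∉ C W C⊆W j∉W) ⟩
    (mem i C ∧ false) ∨ sameCluster G Cs i j
      ≡⟨ cong (_∨ sameCluster G Cs i j) (∧-zeroʳ (mem i C)) ⟩
    sameCluster G Cs i j
      ≡⟨ sameCluster-∉ʳ W Cs⊆W j∉W ⟩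
    false ∎
    where open ≡-Reasoning

  pairCount : (Bool → Fin n → Fin n → ℕ) → Subset n → List (Subset n) → ℕ
  pairCount w V Cs = ∑[ i ∈ V ] ∑[ j ∈ V ] w (sameCluster G Cs i j) i j

  pairCount-empty : ∀ w V Cs → (∀ i → mem i V ≡ false) → pairCount w V Cs ≡ 0
  pairCount-empty w V Cs V≡∅ = ∑∈-empty V (λ i → ∑[ j ∈ V ] w (sameCluster G Cs i j) i j) V≡∅

  pairCount-step : ∀ w V k {Cs} → mem k V ≡ true → All (_⊆ᵇ (V ─ cluster G V k)) Cs →
    let C = cluster G V k ; R = V ─ cluster G V k in
    pairCount w V (C ∷ Cs)
    ≡ ((∑[ i ∈ C ] ∑[ j ∈ C ] w true i j) + (∑[ i ∈ C ] ∑[ j ∈ R ] w false i j))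
      + ((∑[ i ∈ R ] ∑[ j ∈ C ] w false i j) + pairCount w R Cs)
  pairCount-step w V k {Cs} k∈V Cs⊆R = trans (∑∈²-split C V (cluster-⊆ V k k∈V) _)
    (cong₂ _+_ (cong₂ _+_ (∑∈-cong C λ i∈C → ∑∈-cong C λ j∈C → cong (w-at _ _) (same-CC i∈C j∈C))
                          (∑∈-cong C λ i∈C → ∑∈-cong R λ j∈R → cong (w-at _ _) (same-CR i∈C j∈R)))
               (cong₂ _+_ (∑∈-cong R λ i∈R → ∑∈-cong C λ j∈C → cong (w-at _ _) (same-RC i∈R j∈C))
                          (∑∈-cong R λ i∈R → ∑∈-cong R λ _ → cong (w-at _ _) (same-R· i∈R))))
    where
    C = cluster G V k
    R = V ─ C
    w-at : Fin n → Fin n → Bool → ℕ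
    w-at i j s = w s i j
    C∉R : ∀ {i} → mem i C ≡ true → mem i R ≡ false
    C∉R {i} i∈C rewrite mem-─ V C i | i∈C = ∧-zeroʳ (mem i V)
    same-CC : ∀ {i j} → mem i C ≡ true → mem j C ≡ true → sameCluster G (C ∷ Cs) i j ≡ true
    same-CC {i} {j} i∈C j∈C = cong₂ (λ a b → (a ∧ b) ∨ sameCluster G Cs i j) i∈C j∈C
    same-R· : ∀ {i j} → mem i R ≡ true → sameCluster G (C ∷ Cs) i j ≡ sameCluster G Cs i j
    same-R· {i} {j} i∈R = cong (λ a → (a ∧ mem j C) ∨ sameCluster G Cs i j) (─-∉ V C i∈R)
    same-CR : ∀ {i j} → mem i C ≡ true → mem j R ≡ true → sameCluster G (C ∷ Cs) i j ≡ false
    same-CR {i} {j} i∈C j∈R =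
      trans (cong₂ (λ a b → (a ∧ b) ∨ sameCluster G Cs i j) i∈C (─-∉ V C j∈R))
            (sameCluster-∉ˡ R Cs⊆R (C∉R i∈C))
    same-RC : ∀ {i j} → mem i R ≡ true → mem j C ≡ true → sameCluster G (C ∷ Cs) i j ≡ false
    same-RC i∈R j∈C = trans (same-R· i∈R) (sameCluster-∉ʳ R Cs⊆R (C∉R j∈C))

  cutWeight intraWeight : Bool → Fin n → Fin n → ℕ
  cutWeight   same i j = if same then 0 else ⟦ i <ᶠ j ∧ adj G i j ⟧
  intraWeight same i j = if same then ⟦ i <ᶠ j ∧ not (adj G i j) ⟧ else 0

  cutIn intraIn : Subset n → List (Subset n) → ℕ
  cutIn   = pairCount cutWeight
  intraIn = pairCount intraWeight

  cutEdges≡cutIn : ∀ Cs → cutEdges G Cs ≡ cutIn ⊤ Cs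
  cutEdges≡cutIn Cs = trans (countUnordered-⊤ λ i j → adj G i j ∧ not (sameCluster G Cs i j))
    (∑∈-cong ⊤ λ {i} _ → ∑∈-cong ⊤ λ {j} _ →
      trans (⟦∧-∧⟧ (i <ᶠ j) (adj G i j) _) (if-not (sameCluster G Cs i j)))

  intraNonEdges≡intraIn : ∀ Cs → intraNonEdges G Cs ≡ intraIn ⊤ Cs
  intraNonEdges≡intraIn Cs = trans (countUnordered-⊤ λ i j → not (adj G i j) ∧ sameCluster G Cs i j)
    (∑∈-cong ⊤ λ {i} _ → ∑∈-cong ⊤ λ {j} _ → ⟦∧-∧⟧ (i <ᶠ j) (not (adj G i j)) (sameCluster G Cs i j))

  ⟦distinct∧adj⟧ : ∀ i j → ⟦ not (does (i ≟ j)) ∧ adj G i j ⟧ ≡ ⟦ adj G i j ⟧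
  ⟦distinct∧adj⟧ i j with i ≟ j
  ... | yes refl rewrite irrefl G i = refl
  ... | no _     = refl

  cut-step : ∀ V k {Cs} → mem k V ≡ true → All (_⊆ᵇ (V ─ cluster G V k)) Cs →
             cutIn V (cluster G V k ∷ Cs) ≡ Bk G V k + cutIn (V ─ cluster G V k) Cs
  cut-step V k {Cs} k∈V Cs⊆R = begin
    cutIn V (C ∷ Cs)
      ≡⟨ pairCount-step cutWeight V k k∈V Cs⊆R ⟩
    ((∑[ i ∈ C ] ∑[ j ∈ C ] 0) + X) + (Y + cutIn R Cs)
      ≡⟨ cong (λ z → (z + X) + (Y + cutIn R Cs)) (∑∈²-zero C C) ⟩
    X + (Y + cutIn R Cs)
      ≡⟨ +-assoc X Y (cutIn R Cs) ⟨
    (X + Y) + cutIn R Cs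
      ≡⟨ cong (_+ cutIn R Cs) (∑∈-unordered C R (adj G) (adj-sym G)) ⟩
    (∑[ i ∈ C ] ∑[ j ∈ R ] ⟦ not (does (i ≟ j)) ∧ adj G i j ⟧) + cutIn R Cs
      ≡⟨ cong (_+ cutIn R Cs) (∑∈-cong C λ {i} _ → ∑∈-cong R λ {j} _ → ⟦distinct∧adj⟧ i j) ⟩
    (∑[ i ∈ C ] ∑[ j ∈ R ] ⟦ adj G i j ⟧) + cutIn R Cs
      ≡⟨ cong (_+ cutIn R Cs) (countOrdered-∈ C R (adj G)) ⟨
    Bk G V k + cutIn R Cs ∎
    where
    open ≡-Reasoning
    C = cluster G V k
    R = V ─ C
    X = ∑[ i ∈ C ] ∑[ j ∈ R ] ⟦ i <ᶠ j ∧ adj G i j ⟧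
    Y = ∑[ i ∈ R ] ∑[ j ∈ C ] ⟦ i <ᶠ j ∧ adj G i j ⟧

  intra-step : ∀ V k {Cs} → mem k V ≡ true → All (_⊆ᵇ (V ─ cluster G V k)) Cs →
               intraIn V (cluster G V k ∷ Cs) ≡ Nk G V k + intraIn (V ─ cluster G V k) Cs
  intra-step V k {Cs} k∈V Cs⊆R = begin
    intraIn V (C ∷ Cs)
      ≡⟨ pairCount-step intraWeight V k k∈V Cs⊆R ⟩
    (N + (∑[ i ∈ C ] ∑[ j ∈ R ] 0)) + ((∑[ i ∈ R ] ∑[ j ∈ C ] 0) + intraIn R Cs)
      ≡⟨ cong₂ (λ x y → (N + x) + (y + intraIn R Cs)) (∑∈²-zero C R) (∑∈²-zero R C) ⟩
    (N + 0) + intraIn R Cs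
      ≡⟨ cong (_+ intraIn R Cs) (+-identityʳ N) ⟩
    N + intraIn R Cs
      ≡⟨ cong (_+ intraIn R Cs) (countUnordered-∈ C C λ i j → not (adj G i j)) ⟨
    Nk G V k + intraIn R Cs ∎
    where
    open ≡-Reasoning
    C = cluster G V k
    R = V ─ C
    N = ∑[ i ∈ C ] ∑[ j ∈ C ] ⟦ i <ᶠ j ∧ not (adj G i j) ⟧

  -- Comparing B_k with 2 N_k

  apart : Fin n → Fin n → Bool
  apart i j = not (does (i ≟ j)) ∧ not (adj G i j)

  exits gaps : Subset n → Fin n → Fin n → ℕ
  exits V k i = ∑[ j ∈ V ─ cluster G V k ] ⟦ adj G i j ⟧
  gaps  V k i = ∑[ j ∈ cluster G V k ] ⟦ apart i j ⟧

  Bk≡∑exits : ∀ V k → Bk G V k ≡ ∑[ i ∈ cluster G V k ] exits V k i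
  Bk≡∑exits V k = countOrdered-∈ (cluster G V k) (V ─ cluster G V k) (adj G)

  2Nk≡∑gaps : ∀ V k → 2 * Nk G V k ≡ ∑[ i ∈ cluster G V k ] gaps V k i
  2Nk≡∑gaps V k = begin
    2 * Nk G V k
      ≡⟨ cong (Nk G V k +_) (+-identityʳ (Nk G V k)) ⟩
    Nk G V k + Nk G V k
      ≡⟨ cong₂ _+_ (countUnordered-∈ C C ¬adj) (countUnordered-∈ C C ¬adj) ⟩
    N< + N<
      ≡⟨ ∑∈-unordered C C ¬adj (λ i j → cong not (adj-sym G i j)) ⟩
    ∑[ i ∈ C ] gaps V k i ∎
    where
    open ≡-Reasoning
    C = cluster G V k
    ¬adj : Fin n → Fin n → Bool
    ¬adj i j = not (adj G i j)
    N< = ∑[ i ∈ C ] ∑[ j ∈ C ] ⟦ i <ᶠ j ∧ ¬adj i j ⟧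

  ∑∈-trichotomy : ∀ A {i} → mem i A ≡ true →
                  ∑[ j ∈ A ] 1 ≡ suc ((∑[ j ∈ A ] ⟦ adj G i j ⟧) + (∑[ j ∈ A ] ⟦ apart i j ⟧))
  ∑∈-trichotomy A {i} i∈A = begin
    ∑[ j ∈ A ] 1
      ≡⟨ ∑∈-cong A (λ {j} _ → self-adj-apart j) ⟩
    ∑[ j ∈ A ] ((if does (i ≟ j) then 1 else 0) + (⟦ adj G i j ⟧ + ⟦ apart i j ⟧))
      ≡⟨ ∑∈-distrib-+ A _ _ ⟩
    (∑[ j ∈ A ] (if does (i ≟ j) then 1 else 0)) + (∑[ j ∈ A ] (⟦ adj G i j ⟧ + ⟦ apart i j ⟧))
      ≡⟨ cong₂ _+_ (∑∈-δ A (λ _ → 1) i∈A) (∑∈-distrib-+ A _ _) ⟩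
    suc ((∑[ j ∈ A ] ⟦ adj G i j ⟧) + (∑[ j ∈ A ] ⟦ apart i j ⟧)) ∎
    where
    open ≡-Reasoning
    self-adj-apart : ∀ j → 1 ≡ (if does (i ≟ j) then 1 else 0)
                               + (⟦ adj G i j ⟧ + ⟦ not (does (i ≟ j)) ∧ not (adj G i j) ⟧)
    self-adj-apart j with i ≟ j | adj G i j in aᵢⱼ
    ... | yes refl | true  = case trans (sym aᵢⱼ) (irrefl G i) of λ ()
    ... | yes refl | false = refl
    ... | no _     | true  = refl
    ... | no _     | false = refl

  exits≤gaps : ∀ V k {i} → mem k V ≡ true → mem i (cluster G V k) ≡ true →
               deg G V i ≤ deg G V k → exits V k i ≤ gaps V k i
  exits≤gaps V k {i} k∈V i∈C degᵢ≤degₖ = +-cancelˡ-≤ inᵢ (exits V k i) (gaps V k i) (begin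
    inᵢ + exits V k i  ≡⟨ trans (deg-∑∈ V i) (∑∈-split C V (cluster-⊆ V k k∈V) _) ⟨
    deg G V i          ≤⟨ degᵢ≤degₖ ⟩
    deg G V k          ≡⟨ suc-injective (trans (sym (cluster-size V k)) (∑∈-trichotomy C i∈C)) ⟩
    inᵢ + gaps V k i   ∎)
    where
    open ≤-Reasoning
    C = cluster G V k
    inᵢ = ∑[ j ∈ C ] ⟦ adj G i j ⟧

  strategy1-bound : ∀ V k → mem k V ≡ true → Strategy1 G V k → Bk G V k ≤ 2 * Nk G V k
  strategy1-bound V k k∈V maxdeg = begin
    Bk G V k                ≡⟨ Bk≡∑exits V k ⟩
    ∑[ i ∈ C ] exits V k i  ≤⟨ ∑∈-mono-≤ C (λ i∈C → exits≤gaps V k k∈V i∈C (degᵢ≤degₖ i∈C)) ⟩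
    ∑[ i ∈ C ] gaps V k i   ≡⟨ 2Nk≡∑gaps V k ⟨
    2 * Nk G V k            ∎
    where
    open ≤-Reasoning
    C = cluster G V k
    degᵢ≤degₖ : ∀ {i} → mem i C ≡ true → deg G V i ≤ deg G V k
    degᵢ≤degₖ i∈C = maxdeg _ (≡⇒T (cluster-⊆ V k k∈V i∈C))

  exits-pivot : ∀ V k → exits V k k ≡ 0
  exits-pivot V k = ∑∈-zero (V ─ cluster G V k) λ j∈R → cong ⟦_⟧ (rest-nonadjacent V k j∈R)

  gaps-pivot : ∀ V k → gaps V k k ≡ 0
  gaps-pivot V k = ∑∈-zero (cluster G V k) λ {j} j∈C → pointwise j j∈C
    where
    pointwise : ∀ j → mem j (cluster G V k) ≡ true → ⟦ not (does (k ≟ j)) ∧ not (adj G k j) ⟧ ≡ 0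
    pointwise j j∈C with k ≟ j | mem-cluster V k j
    ... | yes _ | _      = refl
    ... | no _  | C≡nbhd rewrite ∧-trueʳ {mem j V} {adj G k j} (trans (sym C≡nbhd) j∈C) = refl

  exits≡gaps : ∀ V k i → adj G k i ≡ true → exits V k i ≡ gaps V i k
  exits≡gaps V k i aₖᵢ = begin
    exits V k i
      ≡⟨ ∑∈-filter (V ─ C) V (λ j → not (mem j C)) (λ j → ⟦ adj G i j ⟧) (mem-─ V C) ⟩
    ∑[ j ∈ V ] (if not (mem j C) then ⟦ adj G i j ⟧ else 0)
      ≡⟨ ∑∈-cong V (λ {j} j∈V → pointwise j j∈V) ⟩
    ∑[ j ∈ V ] (if adj G i j then f j else 0)
      ≡⟨ ∑∈-filter (nbhd G V i) V (adj G i) f (mem-nbhd V i) ⟨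
    ∑∈ (nbhd G V i) f
      ≡⟨ ∑∈-cluster-nbhd V i f fᵢ≡0 ⟨
    gaps V i k ∎
    where
    open ≡-Reasoning
    C = cluster G V k
    f : Fin n → ℕ
    f j = ⟦ apart k j ⟧
    fᵢ≡0 : f i ≡ 0
    fᵢ≡0 rewrite aₖᵢ = cong ⟦_⟧ (∧-zeroʳ (not (does (k ≟ i))))
    pointwise : ∀ j → mem j V ≡ true →
                (if not (mem j C) then ⟦ adj G i j ⟧ else 0) ≡ (if adj G i j then f j else 0)
    pointwise j j∈V rewrite mem-cluster V k j | j∈V with does (k ≟ j) | adj G k j | adj G i j
    ... | true  | _     | true  = refl
    ... | true  | _     | false = refl
    ... | false | true  | true  = refl
    ... | false | true  | false = refl
    ... | false | false | true  = refl
    ... | false | false | false = refl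

  ∑∈-nbhd-swap : ∀ V (F : Fin n → Fin n → ℕ) →
                 ∑[ k ∈ V ] ∑[ i ∈ nbhd G V k ] F k i ≡ ∑[ k ∈ V ] ∑[ i ∈ nbhd G V k ] F i k
  ∑∈-nbhd-swap V F = begin
    ∑[ k ∈ V ] ∑[ i ∈ nbhd G V k ] F k i
      ≡⟨ ∑∈-cong V (λ {k} _ → ∑∈-filter (nbhd G V k) V (adj G k) (F k) (mem-nbhd V k)) ⟩
    ∑[ k ∈ V ] ∑[ i ∈ V ] (if adj G k i then F k i else 0)
      ≡⟨ ∑∈-comm V V (λ k i → if adj G k i then F k i else 0) ⟩
    ∑[ i ∈ V ] ∑[ k ∈ V ] (if adj G k i then F k i else 0)
      ≡⟨ ∑∈-cong V (λ {i} _ → ∑∈-cong V λ {k} _ → cong (if_then F k i else 0) (adj-sym G k i)) ⟩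
    ∑[ i ∈ V ] ∑[ k ∈ V ] (if adj G i k then F k i else 0)
      ≡⟨ ∑∈-cong V (λ {i} _ → ∑∈-filter (nbhd G V i) V (adj G i) (λ k → F k i) (mem-nbhd V i)) ⟨
    ∑[ i ∈ V ] ∑[ k ∈ nbhd G V i ] F k i ∎
    where open ≡-Reasoning

  wedge : ∀ V → ∑[ k ∈ V ] Bk G V k ≡ 2 * (∑[ k ∈ V ] Nk G V k)
  wedge V = begin
    ∑[ k ∈ V ] Bk G V k
      ≡⟨ ∑∈-cong V (λ {k} _ → trans (Bk≡∑exits V k) (∑∈-cluster-nbhd V k _ (exits-pivot V k))) ⟩
    ∑[ k ∈ V ] ∑[ i ∈ nbhd G V k ] exits V k i
      ≡⟨ ∑∈-cong V (λ {k} _ → ∑∈-cong (nbhd G V k) λ {i} i∈N →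
           exits≡gaps V k i (∧-trueʳ (trans (sym (mem-nbhd V k i)) i∈N))) ⟩
    ∑[ k ∈ V ] ∑[ i ∈ nbhd G V k ] gaps V i k
      ≡⟨ ∑∈-nbhd-swap V (λ k i → gaps V i k) ⟩
    ∑[ k ∈ V ] ∑[ i ∈ nbhd G V k ] gaps V k i
      ≡⟨ ∑∈-cong V (λ {k} _ → trans (2Nk≡∑gaps V k) (∑∈-cluster-nbhd V k _ (gaps-pivot V k))) ⟨
    ∑[ k ∈ V ] (2 * Nk G V k)
      ≡⟨ *-distribˡ-∑∈ 2 V (Nk G V) ⟨
    2 * (∑[ k ∈ V ] Nk G V k) ∎
    where open ≡-Reasoning

  pivot-bound : ∀ V k → mem k V ≡ true → Strategy1 G V k ⊎ Strategy2 G V k → Bk G V k ≤ 2 * Nk G V k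
  pivot-bound V k k∈V (inj₁ maxdeg)   = strategy1-bound V k k∈V maxdeg
  pivot-bound V k k∈V (inj₂ minratio) =
    ratio-min-≤ V (Bk G V) (Nk G V) 2 k∈V (λ {k′} k′∈V → minratio k′ (≡⇒T k′∈V)) (wedge V)

  run-inside : ∀ {P V Cs} → PivotRun G P V Cs → All (_⊆ᵇ V) Cs
  run-inside done                   = []
  run-inside (step {V} k k∈V _ run) = clusters-inside V k (T⇒≡ k∈V) (run-inside run)

  run-bound : ∀ {V Cs} → PivotRun G (λ V k → Strategy1 G V k ⊎ Strategy2 G V k) V Cs →
              cutIn V Cs ≤ 2 * intraIn V Cs
  run-bound done = ≤-trans (≤-reflexive (pairCount-empty cutWeight ⊥ [] mem-⊥)) z≤n
  run-bound (step {V} {Cs} k k∈V pivot run) = begin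
    cutIn V (C ∷ Cs)                       ≡⟨ cut-step V k (T⇒≡ k∈V) (run-inside run) ⟩
    Bk G V k + cutIn R Cs                  ≤⟨ +-mono-≤ (pivot-bound V k (T⇒≡ k∈V) pivot) (run-bound run) ⟩
    2 * Nk G V k + 2 * intraIn R Cs        ≡⟨ *-distribˡ-+ 2 (Nk G V k) (intraIn R Cs) ⟨
    2 * (Nk G V k + intraIn R Cs)          ≡⟨ cong (2 *_) (intra-step V k (T⇒≡ k∈V) (run-inside run)) ⟨
    2 * intraIn V (C ∷ Cs)                 ∎
    where
    open ≤-Reasoning
    C = cluster G V k
    R = V ─ C

  strategies-1-2-bound : ∀ Cs → PivotRun G (λ V k → Strategy1 G V k ⊎ Strategy2 G V k) ⊤ Cs →
                         cutEdges G Cs ≤ 2 * intraNonEdges G Cs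
  strategies-1-2-bound Cs run =
    subst₂ (λ c i → c ≤ 2 * i) (sym (cutEdges≡cutIn Cs)) (sym (intraNonEdges≡intraIn Cs)) (run-bound run)

toℚ : ℕ → ℚ
toℚ m = ℤ.+ m / 1

toℚ≡mkℚ : ∀ m → toℚ m ≡ mkℚ (ℤ.+ m) 0 (Coprime.sym (Coprime.1-coprimeTo m))
toℚ≡mkℚ m = ℚP.normalize-coprime (Coprime.sym (Coprime.1-coprimeTo m))

toℚ-+ : ∀ a b → toℚ (a + b) ≡ toℚ a +ℚ toℚ b
toℚ-+ a b = begin
  toℚ (a + b)
    ≡⟨ ℚP./-cong (cong₂ ℤ._+_ (ℤP.*-identityʳ (ℤ.+ a)) (ℤP.*-identityʳ (ℤ.+ b))) refl ⟨
  -- the sum of mkℚ (ℤ.+ a) 0 _ and mkℚ (ℤ.+ b) 0 _, unfolded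
  (ℤ.+ a ℤ.* ℤ.+ 1 ℤ.+ ℤ.+ b ℤ.* ℤ.+ 1) / 1
    ≡⟨ cong₂ _+ℚ_ (toℚ≡mkℚ a) (toℚ≡mkℚ b) ⟨
  toℚ a +ℚ toℚ b ∎
  where open ≡-Reasoning

toℚ-* : ∀ a b → toℚ (a * b) ≡ toℚ a *ℚ toℚ b
toℚ-* a b = trans (ℚP./-cong (ℤP.pos-* a b) refl) (sym (cong₂ _*ℚ_ (toℚ≡mkℚ a) (toℚ≡mkℚ b)))

toℚ-inverse : ∀ l → toℚ (suc l) *ℚ (ℤ.+ 1 / suc l) ≡ 1ℚ
toℚ-inverse l =
  trans (cong₂ _*ℚ_ (toℚ≡mkℚ (suc l)) (ℚP.normalize-coprime (Coprime.1-coprimeTo (suc l))))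
        (ℚP.*-inverseʳ (mkℚ (ℤ.+ suc l) 0 (Coprime.sym (Coprime.1-coprimeTo (suc l)))))

*-toℚ-cancel : ∀ s l → s *ℚ (ℤ.+ 1 / suc l) *ℚ toℚ (suc l) ≡ s
*-toℚ-cancel s l = begin
  s *ℚ r *ℚ toℚ (suc l)   ≡⟨ ℚP.*-assoc s r (toℚ (suc l)) ⟩
  s *ℚ (r *ℚ toℚ (suc l)) ≡⟨ cong (s *ℚ_) (trans (ℚP.*-comm r (toℚ (suc l))) (toℚ-inverse l)) ⟩
  s *ℚ 1ℚ                 ≡⟨ ℚP.*-identityʳ s ⟩
  s                       ∎
  where
  open ≡-Reasoning
  r = ℤ.+ 1 / suc l

sumℚ : List ℚ → ℚ
sumℚ = List.foldr _+ℚ_ 0ℚ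

module _ {A : Set} where

  sumℚ-map-+ : ∀ (f g : A → ℚ) xs →
               sumℚ (map (λ x → f x +ℚ g x) xs) ≡ sumℚ (map f xs) +ℚ sumℚ (map g xs)
  sumℚ-map-+ f g []       = refl
  sumℚ-map-+ f g (x ∷ xs) = trans (cong ((f x +ℚ g x) +ℚ_) (sumℚ-map-+ f g xs))
                                  (+ℚ-interchange (f x) (g x) (sumℚ (map f xs)) (sumℚ (map g xs)))

  sumℚ-map-*ˡ : ∀ c (f : A → ℚ) xs → sumℚ (map (λ x → c *ℚ f x) xs) ≡ c *ℚ sumℚ (map f xs)
  sumℚ-map-*ˡ c f []       = sym (ℚP.*-zeroʳ c)
  sumℚ-map-*ˡ c f (x ∷ xs) = trans (cong (c *ℚ f x +ℚ_) (sumℚ-map-*ˡ c f xs))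
                                   (sym (ℚP.*-distribˡ-+ c (f x) (sumℚ (map f xs))))

  sumℚ-map-const : ∀ c (xs : List A) → sumℚ (map (λ _ → c) xs) ≡ toℚ (length xs) *ℚ c
  sumℚ-map-const c []       = sym (ℚP.*-zeroˡ c)
  sumℚ-map-const c (x ∷ xs) = begin
    c +ℚ sumℚ (map (λ _ → c) xs)    ≡⟨ cong (c +ℚ_) (sumℚ-map-const c xs) ⟩
    c +ℚ toℚ (length xs) *ℚ c       ≡⟨ cong (_+ℚ toℚ (length xs) *ℚ c) (ℚP.*-identityˡ c) ⟨
    1ℚ *ℚ c +ℚ toℚ (length xs) *ℚ c ≡⟨ ℚP.*-distribʳ-+ c 1ℚ (toℚ (length xs)) ⟨
    (1ℚ +ℚ toℚ (length xs)) *ℚ c    ≡⟨ cong (_*ℚ c) (toℚ-+ 1 (length xs)) ⟨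
    toℚ (suc (length xs)) *ℚ c      ∎
    where open ≡-Reasoning

  sumℚ-map-toℚ : ∀ (f : A → ℕ) xs → sumℚ (map (λ x → toℚ (f x)) xs) ≡ toℚ (sumˡ (map f xs))
  sumℚ-map-toℚ f []       = refl
  sumℚ-map-toℚ f (x ∷ xs) =
    trans (cong (toℚ (f x) +ℚ_) (sumℚ-map-toℚ f xs)) (sym (toℚ-+ (f x) (sumˡ (map f xs))))

sumˡ-map-filterᵇ-tabulate : ∀ {A : Set} {m} (q : A → Bool) (g : A → ℕ) (f : Fin m → A) →
                            sumˡ (map g (filterᵇ q (List.tabulate f)))
                            ≡ sum (λ i → if q (f i) then g (f i) else 0)
sumˡ-map-filterᵇ-tabulate {m = zero}  q g f = refl
sumˡ-map-filterᵇ-tabulate {m = suc m} q g f with q (f zero)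
... | true  = cong (g (f zero) +_) (sumˡ-map-filterᵇ-tabulate q g (f ∘ suc))
... | false = sumˡ-map-filterᵇ-tabulate q g (f ∘ suc)

-- Random pivots

module _ {n : ℕ} (G : Graph n) where

  sumˡ-map-elems : ∀ V (f : Fin n → ℕ) → sumˡ (map f (elems V)) ≡ ∑∈ V f
  sumˡ-map-elems V f = sumˡ-map-filterᵇ-tabulate (λ i → mem i V) f id

  elems-⊆ : ∀ V → All (λ k → mem k V ≡ true) (elems V)
  elems-⊆ V = All.map T⇒≡ (all-filter (T? ∘ λ i → mem i V) (List.allFin n))

  -- The list sum inside avg is local to a where-block of Defs and cannot be named; it is
  -- related to sumℚ by instantiating *-toℚ-cancel with that hidden sum.
  avg-scaled : ∀ x xs → avg G (x ∷ xs) *ℚ toℚ (suc (length xs)) ≡ sumℚ (x ∷ xs)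
  avg-scaled x []       = *-toℚ-cancel _ 0
  avg-scaled x (y ∷ ys) = trans (*-toℚ-cancel _ (suc (length ys)))
    (cong (x +ℚ_) (trans (sym (*-toℚ-cancel _ (length ys))) (avg-scaled y ys)))

  module _ {A : Set} (k : A) (ks : List A) where

    private
      xs = k ∷ ks
      l  = length ks
      r  = ℤ.+ 1 / suc l

    avg-map : ∀ (F : A → ℚ) → avg G (map F xs) ≡ sumℚ (map F xs) *ℚ r
    avg-map F = begin
      a                                   ≡⟨ ℚP.*-identityʳ a ⟨
      a *ℚ 1ℚ                             ≡⟨ cong (a *ℚ_) (toℚ-inverse l) ⟨
      a *ℚ (toℚ (suc l) *ℚ r)             ≡⟨ ℚP.*-assoc a (toℚ (suc l)) r ⟨
      a *ℚ toℚ (suc l) *ℚ r               ≡⟨ cong (λ l′ → a *ℚ toℚ (suc l′) *ℚ r) (length-map F ks) ⟨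
      a *ℚ toℚ (suc (length (map F ks))) *ℚ r ≡⟨ cong (_*ℚ r) (avg-scaled (F k) (map F ks)) ⟩
      sumℚ (map F xs) *ℚ r                ∎
      where
      open ≡-Reasoning
      a = avg G (map F xs)

    avg-map-+ : ∀ (F H : A → ℚ) →
                avg G (map (λ x → F x +ℚ H x) xs) ≡ avg G (map F xs) +ℚ avg G (map H xs)
    avg-map-+ F H = begin
      avg G (map (λ x → F x +ℚ H x) xs)      ≡⟨ avg-map (λ x → F x +ℚ H x) ⟩
      sumℚ (map (λ x → F x +ℚ H x) xs) *ℚ r  ≡⟨ cong (_*ℚ r) (sumℚ-map-+ F H xs) ⟩
      (ΣF +ℚ ΣH) *ℚ r                        ≡⟨ ℚP.*-distribʳ-+ r ΣF ΣH ⟩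
      ΣF *ℚ r +ℚ ΣH *ℚ r                     ≡⟨ cong₂ _+ℚ_ (avg-map F) (avg-map H) ⟨
      avg G (map F xs) +ℚ avg G (map H xs)   ∎
      where
      open ≡-Reasoning
      ΣF = sumℚ (map F xs)
      ΣH = sumℚ (map H xs)

    avg-map-*ˡ : ∀ c (F : A → ℚ) → avg G (map (λ x → c *ℚ F x) xs) ≡ c *ℚ avg G (map F xs)
    avg-map-*ˡ c F = begin
      avg G (map (λ x → c *ℚ F x) xs)      ≡⟨ avg-map (λ x → c *ℚ F x) ⟩
      sumℚ (map (λ x → c *ℚ F x) xs) *ℚ r  ≡⟨ cong (_*ℚ r) (sumℚ-map-*ˡ c F xs) ⟩
      c *ℚ sumℚ (map F xs) *ℚ r            ≡⟨ ℚP.*-assoc c (sumℚ (map F xs)) r ⟩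
      c *ℚ (sumℚ (map F xs) *ℚ r)          ≡⟨ cong (c *ℚ_) (avg-map F) ⟨
      c *ℚ avg G (map F xs)                ∎
      where open ≡-Reasoning

    avg-map-const : ∀ c → avg G (map (λ _ → c) xs) ≡ c
    avg-map-const c = begin
      avg G (map (λ _ → c) xs)     ≡⟨ avg-map (λ _ → c) ⟩
      sumℚ (map (λ _ → c) xs) *ℚ r ≡⟨ cong (_*ℚ r) (trans (sumℚ-map-const c xs) (ℚP.*-comm (toℚ (suc l)) c)) ⟩
      c *ℚ toℚ (suc l) *ℚ r        ≡⟨ ℚP.*-assoc c (toℚ (suc l)) r ⟩
      c *ℚ (toℚ (suc l) *ℚ r)      ≡⟨ cong (c *ℚ_) (toℚ-inverse l) ⟩
      c *ℚ 1ℚ                      ≡⟨ ℚP.*-identityʳ c ⟩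
      c                            ∎
      where open ≡-Reasoning

    avg-map-toℚ : ∀ c (f g : A → ℕ) → sumˡ (map f xs) ≡ c * sumˡ (map g xs) →
                  avg G (map (λ x → toℚ (f x)) xs) ≡ toℚ c *ℚ avg G (map (λ x → toℚ (g x)) xs)
    avg-map-toℚ c f g ∑f≡c∑g = begin
      avg G (map (λ x → toℚ (f x)) xs)        ≡⟨ avg-map (λ x → toℚ (f x)) ⟩
      sumℚ (map (λ x → toℚ (f x)) xs) *ℚ r    ≡⟨ cong (_*ℚ r) (trans (sumℚ-map-toℚ f xs) (cong toℚ ∑f≡c∑g)) ⟩
      toℚ (c * ∑g) *ℚ r                       ≡⟨ cong (_*ℚ r) (toℚ-* c ∑g) ⟩
      toℚ c *ℚ toℚ ∑g *ℚ r                    ≡⟨ ℚP.*-assoc (toℚ c) (toℚ ∑g) r ⟩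
      toℚ c *ℚ (toℚ ∑g *ℚ r)                  ≡⟨ cong (λ z → toℚ c *ℚ (z *ℚ r)) (sumℚ-map-toℚ g xs) ⟨
      toℚ c *ℚ (sumℚ (map (λ x → toℚ (g x)) xs) *ℚ r) ≡⟨ cong (toℚ c *ℚ_) (avg-map (λ x → toℚ (g x))) ⟨
      toℚ c *ℚ avg G (map (λ x → toℚ (g x)) xs) ∎
      where
      open ≡-Reasoning
      ∑g = sumˡ (map g xs)

    avg-map-twice : ∀ (B N : A → ℕ) (I : A → ℚ) → sumˡ (map B xs) ≡ 2 * sumˡ (map N xs) →
                    avg G (map (λ x → toℚ (B x) +ℚ toℚ 2 *ℚ I x) xs)
                    ≡ toℚ 2 *ℚ avg G (map (λ x → toℚ (N x) +ℚ I x) xs)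
    avg-map-twice B N I ∑B≡2∑N = begin
      avg G (map (λ x → toℚ (B x) +ℚ toℚ 2 *ℚ I x) xs)
        ≡⟨ avg-map-+ (λ x → toℚ (B x)) (λ x → toℚ 2 *ℚ I x) ⟩
      avg G (map (λ x → toℚ (B x)) xs) +ℚ avg G (map (λ x → toℚ 2 *ℚ I x) xs)
        ≡⟨ cong₂ _+ℚ_ (avg-map-toℚ 2 B N ∑B≡2∑N) (avg-map-*ˡ (toℚ 2) I) ⟩
      toℚ 2 *ℚ avg-N +ℚ toℚ 2 *ℚ avg G (map I xs)
        ≡⟨ ℚP.*-distribˡ-+ (toℚ 2) avg-N (avg G (map I xs)) ⟨
      toℚ 2 *ℚ (avg-N +ℚ avg G (map I xs))
        ≡⟨ cong (toℚ 2 *ℚ_) (avg-map-+ (λ x → toℚ (N x)) I) ⟨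
      toℚ 2 *ℚ avg G (map (λ x → toℚ (N x) +ℚ I x) xs) ∎
      where
      open ≡-Reasoning
      avg-N = avg G (map (λ x → toℚ (N x)) xs)

  expectRandom-cong : ∀ fuel V {f g : List (Subset n) → ℚ} → (∀ Cs → All (_⊆ᵇ V) Cs → f Cs ≡ g Cs) →
                      expectRandom G fuel V f ≡ expectRandom G fuel V g
  expectRandom-cong zero       V f≡g = f≡g [] []
  expectRandom-cong (suc fuel) V {f} {g} f≡g with elems V | elems-⊆ V
  ... | []     | _    = f≡g [] []
  ... | k ∷ ks | ks⊆V = cong (avg G) (map-cong-local (All.map branch ks⊆V))
    where
    branch : ∀ {k} → mem k V ≡ true →
             expectRandom G fuel (V ─ cluster G V k) (λ Cs → f (cluster G V k ∷ Cs))
             ≡ expectRandom G fuel (V ─ cluster G V k) (λ Cs → g (cluster G V k ∷ Cs))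
    branch {k} k∈V = expectRandom-cong fuel (V ─ cluster G V k) λ Cs Cs⊆R →
                       f≡g (cluster G V k ∷ Cs) (clusters-inside G V k k∈V Cs⊆R)

  expectRandom-shift : ∀ fuel V c (f : List (Subset n) → ℚ) →
                       expectRandom G fuel V (λ Cs → c +ℚ f Cs) ≡ c +ℚ expectRandom G fuel V f
  expectRandom-shift zero       V c f = refl
  expectRandom-shift (suc fuel) V c f with elems V
  ... | []     = refl
  ... | k ∷ ks = begin
    avg G (map (λ k → expectRandom G fuel (R k) (λ Cs → c +ℚ f (C k ∷ Cs))) (k ∷ ks))
      ≡⟨ cong (avg G) (map-cong (λ k → expectRandom-shift fuel (R k) c (λ Cs → f (C k ∷ Cs))) (k ∷ ks)) ⟩
    avg G (map (λ k → c +ℚ X k) (k ∷ ks))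
      ≡⟨ avg-map-+ k ks (λ _ → c) X ⟩
    avg G (map (λ _ → c) (k ∷ ks)) +ℚ avg G (map X (k ∷ ks))
      ≡⟨ cong (_+ℚ avg G (map X (k ∷ ks))) (avg-map-const k ks c) ⟩
    c +ℚ avg G (map X (k ∷ ks)) ∎
    where
    open ≡-Reasoning
    C R : Fin n → Subset n
    C k = cluster G V k
    R k = V ─ C k
    X : Fin n → ℚ
    X k = expectRandom G fuel (R k) (λ Cs → f (C k ∷ Cs))

  expectRandom-offset : ∀ fuel V a (h h′ : List (Subset n) → ℕ) →
                        (∀ Cs → All (_⊆ᵇ V) Cs → h Cs ≡ a + h′ Cs) →
                        expectRandom G fuel V (λ Cs → toℚ (h Cs))
                        ≡ toℚ a +ℚ expectRandom G fuel V (λ Cs → toℚ (h′ Cs))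
  expectRandom-offset fuel V a h h′ h≡a+h′ =
    trans (expectRandom-cong fuel V λ Cs Cs⊆V → trans (cong toℚ (h≡a+h′ Cs Cs⊆V)) (toℚ-+ a (h′ Cs)))
          (expectRandom-shift fuel V (toℚ a) (λ Cs → toℚ (h′ Cs)))

  rest-smaller : ∀ V k → mem k V ≡ true → suc (∑[ i ∈ V ─ cluster G V k ] 1) ≤ ∑[ i ∈ V ] 1
  rest-smaller V k k∈V = begin
    suc |R|                           ≤⟨ s≤s (m≤n+m |R| (deg G V k)) ⟩
    suc (deg G V k) + |R|             ≡⟨ cong (_+ |R|) (cluster-size G V k) ⟨
    (∑[ i ∈ cluster G V k ] 1) + |R|  ≡⟨ ∑∈-split (cluster G V k) V (cluster-⊆ G V k k∈V) (λ _ → 1) ⟨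
    ∑[ i ∈ V ] 1                      ∎
    where
    open ≤-Reasoning
    |R| = ∑[ i ∈ V ─ cluster G V k ] 1

  cut≡2*intra-empty : ∀ V → (∀ i → mem i V ≡ false) → toℚ (cutIn G V []) ≡ toℚ 2 *ℚ toℚ (intraIn G V [])
  cut≡2*intra-empty V V≡∅
    rewrite pairCount-empty G (cutWeight G) V [] V≡∅ | pairCount-empty G (intraWeight G) V [] V≡∅ =
    sym (ℚP.*-zeroʳ (toℚ 2))

  expected-cut≡2*expected-intra : ∀ fuel V → ∑[ i ∈ V ] 1 ≤ fuel →
                                  expectRandom G fuel V (λ Cs → toℚ (cutIn G V Cs))
                                  ≡ toℚ 2 *ℚ expectRandom G fuel V (λ Cs → toℚ (intraIn G V Cs))
  expected-cut≡2*expected-intra zero V |V|≤0 = cut≡2*intra-empty V (size≤0⇒empty V |V|≤0)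
  expected-cut≡2*expected-intra (suc fuel) V |V|≤1+fuel
    with elems V | elems-⊆ V | sumˡ-map-elems V (λ _ → 1)
       | sumˡ-map-elems V (Bk G V) | sumˡ-map-elems V (Nk G V)
  ... | []     | _    | 0≡|V| | _  | _  = cut≡2*intra-empty V (size≤0⇒empty V (≤-reflexive (sym 0≡|V|)))
  ... | k ∷ ks | ks⊆V | _     | ∑B | ∑N = begin
    avg G (map (λ k → E (R k) (λ Cs → toℚ (cutIn G V (C k ∷ Cs)))) (k ∷ ks))
      ≡⟨ cong (avg G) (map-cong-local (All.map cut-branch ks⊆V)) ⟩
    avg G (map (λ k → toℚ (Bk G V k) +ℚ toℚ 2 *ℚ I k) (k ∷ ks))
      ≡⟨ avg-map-twice k ks (Bk G V) (Nk G V) I (trans ∑B (trans (wedge G V) (cong (2 *_) (sym ∑N)))) ⟩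
    toℚ 2 *ℚ avg G (map (λ k → toℚ (Nk G V k) +ℚ I k) (k ∷ ks))
      ≡⟨ cong (λ ys → toℚ 2 *ℚ avg G ys) (map-cong-local (All.map intra-branch ks⊆V)) ⟨
    toℚ 2 *ℚ avg G (map (λ k → E (R k) (λ Cs → toℚ (intraIn G V (C k ∷ Cs)))) (k ∷ ks)) ∎
    where
    open ≡-Reasoning
    E : Subset n → (List (Subset n) → ℚ) → ℚ
    E = expectRandom G fuel
    C R : Fin n → Subset n
    C k = cluster G V k
    R k = V ─ C k
    I : Fin n → ℚ
    I k = E (R k) (λ Cs → toℚ (intraIn G (R k) Cs))
    cut-branch : ∀ {k} → mem k V ≡ true →
                 E (R k) (λ Cs → toℚ (cutIn G V (C k ∷ Cs))) ≡ toℚ (Bk G V k) +ℚ toℚ 2 *ℚ I k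
    cut-branch {k} k∈V =
      trans (expectRandom-offset fuel (R k) (Bk G V k) _ _ λ Cs → cut-step G V k k∈V)
            (cong (toℚ (Bk G V k) +ℚ_) (expected-cut≡2*expected-intra fuel (R k) |R|≤fuel))
      where
      |R|≤fuel : ∑[ i ∈ R k ] 1 ≤ fuel
      |R|≤fuel = ≤-pred (≤-trans (rest-smaller V k k∈V) |V|≤1+fuel)
    intra-branch : ∀ {k} → mem k V ≡ true →
                   E (R k) (λ Cs → toℚ (intraIn G V (C k ∷ Cs))) ≡ toℚ (Nk G V k) +ℚ I k
    intra-branch {k} k∈V = expectRandom-offset fuel (R k) (Nk G V k) _ _ λ Cs → intra-step G V k k∈V

  strategy-3-expectation : expectRandom G n ⊤ (λ Cs → toℚ (cutEdges G Cs))
                           ≡ toℚ 2 *ℚ expectRandom G n ⊤ (λ Cs → toℚ (intraNonEdges G Cs))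
  strategy-3-expectation = begin
    expectRandom G n ⊤ (λ Cs → toℚ (cutEdges G Cs))
      ≡⟨ expectRandom-cong n ⊤ (λ Cs _ → cong toℚ (cutEdges≡cutIn G Cs)) ⟩
    expectRandom G n ⊤ (λ Cs → toℚ (cutIn G ⊤ Cs))
      ≡⟨ expected-cut≡2*expected-intra n ⊤ (≤-reflexive (trans (sym (∣∣≡∑∈ (⊤ {n}))) (∣⊤∣≡n n))) ⟩
    toℚ 2 *ℚ expectRandom G n ⊤ (λ Cs → toℚ (intraIn G ⊤ Cs))
      ≡⟨ cong (toℚ 2 *ℚ_) (expectRandom-cong n ⊤ (λ Cs _ → cong toℚ (intraNonEdges≡intraIn G Cs))) ⟨
    toℚ 2 *ℚ expectRandom G n ⊤ (λ Cs → toℚ (intraNonEdges G Cs)) ∎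
    where open ≡-Reasoning

open import Data.Integer using (+_)

lemma1 : (n : ℕ) (G : Graph n) →
    ((Cs : List (Subset n)) →
       PivotRun G (λ V k → Strategy1 G V k ⊎ Strategy2 G V k) ⊤ Cs →
       cutEdges G Cs ≤ 2 * intraNonEdges G Cs)
    ×
    (expectRandom G n ⊤ (λ Cs → + cutEdges G Cs / 1)
       ≡ (+ 2 / 1) *ℚ expectRandom G n ⊤ (λ Cs → + intraNonEdges G Cs / 1))
lemma1 n G = strategies-1-2-bound G , strategy-3-expectation G
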